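{- Let $G$ be an embedded simple graph of genus $g$ and $e$ an edge of $G$ to which the H-operation can be applied without producing multiple edges or loops. Then $H_e(G)$ is a simple embedded graph of genus $g+1$ that has a $2$-cut, and the dual of $H_e(G)$ is isomorphic to the dual of $G$.
   Context: An embedded graph is a connected graph together with a combinatorial embedding in an orientable surface: every edge $\{v,w\}$ is regarded as two directed edges $(v,w)$ and $(w,v)$, and for every vertex $v$ the directed edges $(v,\cdot)$ are given a cyclic (rotational) order. Faces are the closed facial walks determined by this rotation system; a pair of consecutive edges $(u,x),(u,y)$ in the rotation at $u$ is an angle. The genus $g$ satisfies $v-e+f=2-2g$. The dual has the faces as vertices and, for every edge, an edge joining the two faces containing its two directed edges. A $2$-cut is a set of two vertices whose removal disconnects the graph. Angle identification: if $x\neq x'$ are vertices with rotational orders $e_1,\dots,e_n$ around $x$ and $e'_1,\dots,e'_m$ around $x'$, replacing $x,x'$ by one vertex with rotational order $e_1,\dots,e_n,e'_1,\dots,e'_m$ is called identifying the angles $e_n,e_1$ and $e'_m,e'_1$. H-operation: let $G$ be an embedded simple graph of minimum degree at least $2$ and $x,y$ adjacent vertices of degree $3$ with pairwise different neighbours; let the rotational order around $x$ be $y,w',v$ and around $y$ be $x,w,v'$ (in vertex notation). Let $a_1$ be the predecessor of $x$ in the rotation around $v$, $b_m$ the successor of $x$ in the rotation around $w'$, $a_n$ the successor of $y$ in the rotation around $w$, and $b_1$ the predecessor of $y$ in the rotation around $v'$. The result of identifying the angles $(v,a_1),(v,x)$ and $(v',b_1),(v',y)$, and also the angles $(w,y),(w,a_n)$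 and $(w',x),(w',b_m)$, is denoted $H_{\{x,y\}}(G)$. -}

module Defs where

open import Data.Nat using (ℕ; zero; suc; _+_; _*_; _<_)
open import Data.Fin as Fin using (Fin)
open import Data.Bool as Bool using (Bool; true; false; not)
open import Data.Product using (Σ; ∃; ∃-syntax; _×_; _,_; proj₁; proj₂)
open import Data.Product.Properties using (≡-dec)
open import Data.Sum using (_⊎_)
open import Relation.Nullary using (¬_; yes; no)
open import Relation.Binary.PropositionalEquality using (_≡_; _≢_)
open import Relation.Binary.Construct.Closure.ReflexiveTransitive using (Star)
open import Function.Bundles using (_⇔_; _↔_; Inverse)

-- A graph with m edges has the 2m directed edges (darts) Fin m × Bool;
-- (e , true) and (e , false) are the two directions of edge e.
-- The rotation system is a permutation σ of the darts: σ d is the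
-- successor of d in the cyclic rotational order around the tail of d.
-- Vertices are the σ-orbits (the tail of a dart is its σ-orbit).

Dart : ℕ → Set
Dart m = Fin m × Bool

rev : ∀ {m} → Dart m → Dart m
rev (e , b) = (e , not b)

_≟D_ : ∀ {m} (x y : Dart m) → Relation.Nullary.Dec (x ≡ y)
_≟D_ = ≡-dec Fin._≟_ Bool._≟_

iter : ∀ {A : Set} → (A → A) → ℕ → A → A
iter f zero    x = x
iter f (suc k) x = f (iter f k x)

SameOrbit : ∀ {A : Set} → (A → A) → A → A → Set
SameOrbit π x y = ∃[ k ] iter π k x ≡ y

-- raw rotation data: σ and a claimed inverse σ⁻
record RotSys (m : ℕ) : Set where
  constructor rotSys
  field
    σ  : Dart m → Dart m
    σ⁻ : Dart m → Dart m

τ : ∀ {m} → Dart m → Dart m → Dart m → Dart m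
τ p q z with z ≟D p
... | yes _ = q
... | no _ with z ≟D q
...   | yes _ = p
...   | no _  = z

record Multigraph : Set where
  field
    V    : ℕ
    E    : ℕ
    ends : Fin E → Fin V × Fin V

UPairEq : ∀ {n} → Fin n × Fin n → Fin n × Fin n → Set
UPairEq (a , b) (c , d) = (a ≡ c × b ≡ d) ⊎ (a ≡ d × b ≡ c)

_≅_ : Multigraph → Multigraph → Set
G₁ ≅ G₂ =
  Σ (Fin (Multigraph.V G₁) ↔ Fin (Multigraph.V G₂)) λ ψ →
  Σ (Fin (Multigraph.E G₁) ↔ Fin (Multigraph.E G₂)) λ χ →
  ∀ e → UPairEq (Inverse.to ψ (proj₁ (Multigraph.ends G₁ e)) , Inverse.to ψ (proj₂ (Multigraph.ends G₁ e)))
                (Multigraph.ends G₂ (Inverse.to χ e))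

module _ {m : ℕ} (G : RotSys m) where
  open RotSys G

  SameVertex : Dart m → Dart m → Set
  SameVertex = SameOrbit σ

  -- face permutation: from u→w go to w→(successor of u around w)
  φ : Dart m → Dart m
  φ x = σ (rev x)

  Step : Dart m → Dart m → Set
  Step x y = (y ≡ σ x) ⊎ (y ≡ rev x)

  IsPermutation : Set
  IsPermutation = (∀ x → σ (σ⁻ x) ≡ x) × (∀ x → σ⁻ (σ x) ≡ x)

  Connected : Set
  Connected = ∀ x y → Star Step x y

  IsEmbeddedGraph : Set
  IsEmbeddedGraph = IsPermutation × Connected

  NoLoops : Set
  NoLoops = ∀ x → ¬ SameVertex x (rev x)

  NoMultiEdges : Set
  NoMultiEdges = ∀ x y → SameVertex x y → SameVertex (rev x) (rev y) → x ≡ y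

  IsSimple : Set
  IsSimple = NoLoops × NoMultiEdges

  -- a labelling of the orbits of π by Fin c (so π has exactly c orbits)
  OrbitLabelling : (Dart m → Dart m) → ℕ → Set
  OrbitLabelling π c =
    Σ (Dart m → Fin c) λ lab →
      (∀ i → ∃[ x ] lab x ≡ i) × (∀ x y → (lab x ≡ lab y) ⇔ SameOrbit π x y)

  VertexLabelling : ℕ → Set
  VertexLabelling = OrbitLabelling σ

  FaceLabelling : ℕ → Set
  FaceLabelling = OrbitLabelling φ

  -- Euler: v - e + f = 2 - 2g, written in ℕ as v + f + 2g = 2 + e
  HasGenus : ℕ → Set
  HasGenus g = ∃[ nv ] ∃[ nf ] VertexLabelling nv × FaceLabelling nf × (nv + nf + 2 * g ≡ 2 + m)

  HasDegree : Dart m → ℕ → Set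
  HasDegree x k = (iter σ k x ≡ x) × (∀ j → 0 < j → j < k → iter σ j x ≢ x)

  MinDegree≥2 : Set
  MinDegree≥2 = ∀ x → σ x ≢ x

  Dual : ∀ {f} → FaceLabelling f → Multigraph
  Dual {f} (lab , _) = record { V = f ; E = m ; ends = λ e → (lab (e , true) , lab (e , false)) }

  -- {a , b} (vertices = tails of darts a, b) is a 2-cut
  IsTwoCut : Dart m → Dart m → Set
  IsTwoCut a b =
    ¬ SameVertex a b ×
    ∃[ x ] ∃[ y ] Allowed x × Allowed y × ¬ Star AllowedStep x y
    where
      Allowed : Dart m → Set
      Allowed z = ¬ SameVertex a z × ¬ SameVertex b z
      AllowedStep : Dart m → Dart m → Set
      AllowedStep x y = Allowed x × Allowed y × Step x y

  HasTwoCut : Set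
  HasTwoCut = ∃[ a ] ∃[ b ] IsTwoCut a b

  -- Identifying the angles p,σp (at a vertex with order e₁..eₙ, p = eₙ, σp = e₁)
  -- and q,σq (q = e'ₘ, σq = e'₁): new rotation e₁..eₙ,e'₁..e'ₘ.
  identifyAngles : Dart m → Dart m → RotSys m
  identifyAngles p q = rotSys (λ z → σ (τ p q z)) (λ z → τ p q (σ⁻ z))

  -- H-operation on edge e, with x = tail of (e , true), y = its head.
  -- Around x: dx = x→y, σ dx = x→w', σ² dx = x→v.
  -- Around y: dy = y→x, σ dy = y→w, σ² dy = y→v'.
  module HData (e : Fin m) where
    dx dy dvx dv'y dwy dw'x : Dart m
    dx = (e , true)
    dy = rev dx
    dvx  = rev (σ (σ dx))
    dv'y = rev (σ (σ dy))
    dwy  = rev (σ dy)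
    dw'x = rev (σ dx)
    -- neighbour vertices represented by darts starting there
    nv nw' nw nv' : Dart m
    nv = dvx
    nw' = dw'x
    nw = dwy
    nv' = dv'y

  HApplicable : Fin m → Set
  HApplicable e =
    IsSimple × MinDegree≥2 × HasDegree dx 3 × HasDegree dy 3 ×
    ¬ SameVertex nv nw' × ¬ SameVertex nv nw × ¬ SameVertex nv nv' ×
    ¬ SameVertex nw' nw × ¬ SameVertex nw' nv' × ¬ SameVertex nw nv'
    where open HData e

-- H_e(G): identify angles (v,a₁),(v,x) with (v',b₁),(v',y), and
-- (w,y),(w,aₙ) with (w',x),(w',b_m).
Hop : ∀ {m} → RotSys m → Fin m → RotSys m
Hop G e = identifyAngles (identifyAngles G (σ⁻ dvx) (σ⁻ dv'y)) dwy dw'x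
  where
    open RotSys G
    open HData G e

DualsIsomorphic : ∀ {m m'} → RotSys m → RotSys m' → Set
DualsIsomorphic G H =
  ∀ {f f'} (FG : FaceLabelling G f) (FH : FaceLabelling H f') → Dual G FG ≅ Dual H FH

-- Identifying an angle at a vertex p with one at a different vertex q merges these two
-- vertices and leaves every other rotation unchanged; so H_e(G) is again a connected
-- embedded graph, with the two vertex pairs {v, v′} and {w, w′} merged. A dart bijection κ,
-- reversing xy and swapping two pairs of darts, conjugates the face permutations of G and
-- H_e(G), so both have the same faces: Euler's formula gives genus g + 1, and κ together
-- with the edge exchanges vx ↔ xw′, v′y ↔ yw is an isomorphism of the duals. Finally the
-- merged vertices separate x and y from the rest of H_e(G), since every other edge at x or
-- y leads to them, while simplicity of H_e(G) forces the neighbour a₁ of v (or b₁ of v′)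
-- to lie elsewhere.

module Submission where

open import Defs
open import Data.Nat using (ℕ; suc)
open import Data.Fin using (Fin)
open import Data.Product using (_×_)

open import Data.Nat using (zero; _+_; _*_; _≤_; s≤s; z≤n)
open import Data.Nat.Properties using (+-suc; *-suc)
open import Data.Bool using (Bool; true; false; not)
open import Data.Fin as Fin using (punchOut; punchIn)
open import Data.Fin.Properties using (¬Fin0; punchOut-injective; punchOut-cong; punchOut-punchIn; punchInᵢ≢i)
open import Data.Fin.Permutation using (transpose; _∘ₚ_)
import Data.Fin.Permutation.Components as PC
open import Data.Product using (∃-syntax; _,_; proj₁; proj₂)
open import Data.Sum using (_⊎_; inj₁; inj₂)
open import Data.Empty using (⊥-elim)
open import Relation.Nullary using (¬_; Dec; yes; no)
open import Relation.Nullary.Decidable using (_⊎-dec_)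
open import Relation.Binary.Definitions using (DecidableEquality)
open import Relation.Binary.PropositionalEquality
open import Relation.Binary.Construct.Closure.ReflexiveTransitive using (Star; ε; _◅_; _◅◅_)
open import Function using (_∘_)
open import Function.Bundles using (_↔_; Inverse; mk↔ₛ′; mk⇔; Equivalence)

module _ {A : Set} where

  iter-suc : (f : A → A) (k : ℕ) (x : A) → iter f (suc k) x ≡ iter f k (f x)
  iter-suc f zero    x = refl
  iter-suc f (suc k) x = cong f (iter-suc f k x)

  iter-+ : (f : A → A) (k j : ℕ) (x : A) → iter f (k + j) x ≡ iter f k (iter f j x)
  iter-+ f zero    j x = refl
  iter-+ f (suc k) j x = cong f (iter-+ f k j x)

  module _ {π : A → A} where

    SameOrbit-refl : ∀ {x} → SameOrbit π x x
    SameOrbit-refl = 0 , refl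

    SameOrbit-step : ∀ {x y} → π x ≡ y → SameOrbit π x y
    SameOrbit-step eq = 1 , eq

    SameOrbit-trans : ∀ {x y z} → SameOrbit π x y → SameOrbit π y z → SameOrbit π x z
    SameOrbit-trans {x} (k , refl) (j , refl) = j + k , iter-+ π j k x

    SameOrbit-invariant : {B : Set} (f : A → B) → (∀ x → f (π x) ≡ f x) →
                          ∀ {x y} → SameOrbit π x y → f x ≡ f y
    SameOrbit-invariant f inv (zero  , refl) = refl
    SameOrbit-invariant f inv {x} (suc k , refl) =
      trans (SameOrbit-invariant f inv (k , refl)) (sym (inv (iter π k x)))

    SameOrbit⇒Star : {R : A → A → Set} → (∀ x → R x (π x)) → ∀ {x y} → SameOrbit π x y → Star R x y
    SameOrbit⇒Star step (zero  , refl) = ε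
    SameOrbit⇒Star step {x} (suc k , refl) = SameOrbit⇒Star step (k , refl) ◅◅ (step (iter π k x) ◅ ε)

  SameOrbit-period-3 : {π : A → A} {x : A} → iter π 3 x ≡ x →
                       ∀ {y} → SameOrbit π x y → y ≡ x ⊎ y ≡ π x ⊎ y ≡ π (π x)
  SameOrbit-period-3 {π} {x} period (k , refl) = go k
    where
      go : ∀ k → iter π k x ≡ x ⊎ iter π k x ≡ π x ⊎ iter π k x ≡ π (π x)
      go zero    = inj₁ refl
      go (suc k) with go k
      ... | inj₁ eq        = inj₂ (inj₁ (cong π eq))
      ... | inj₂ (inj₁ eq) = inj₂ (inj₂ (cong π eq))
      ... | inj₂ (inj₂ eq) = inj₁ (trans (cong π eq) period)

  SameOrbit-mono : {π ρ : A → A} → (∀ x → SameOrbit ρ x (π x)) →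
                   ∀ {x y} → SameOrbit π x y → SameOrbit ρ x y
  SameOrbit-mono step (zero  , refl) = 0 , refl
  SameOrbit-mono {π} step {x} (suc k , refl) = SameOrbit-trans (SameOrbit-mono step (k , refl)) (step (iter π k x))

  SameOrbit-agree : DecidableEquality A → {π π′ : A → A} (P : A → Set) {s : A} →
                    (∀ z → P z → P (π z)) → (∀ z → P z → z ≢ s → π′ z ≡ π z) →
                    ∀ {z} → P z → SameOrbit π z s → SameOrbit π′ z s
  SameOrbit-agree _≟_ {π} {π′} P {s} closed agree Pz (k , eq) = go k Pz eq
    where
      go : ∀ k {z} → P z → iter π k z ≡ s → SameOrbit π′ z s
      go zero    Pz eq = 0 , eq
      go (suc k) {z} Pz eq with z ≟ s
      ... | yes z≡s = 0 , z≡s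
      ... | no  z≢s = SameOrbit-trans (SameOrbit-step (agree z Pz z≢s))
                        (go k (closed z Pz) (trans (sym (iter-suc π k z)) eq))

SameOrbit-conjugate : {A B : Set} {π : A → A} {ρ : B → B} (f : A → B) → (∀ x → ρ (f x) ≡ f (π x)) →
                      ∀ {x y} → SameOrbit π x y → SameOrbit ρ (f x) (f y)
SameOrbit-conjugate {π = π} {ρ} f comm {x} (k , refl) = k , conj k
  where
    conj : ∀ k → iter ρ k (f x) ≡ f (iter π k x)
    conj zero    = refl
    conj (suc k) = trans (cong ρ (conj k)) (comm (iter π k x))

module _ {m : ℕ} where

  τ-left : (p q : Dart m) → τ p q p ≡ q
  τ-left p q with p ≟D p
  ... | yes _  = refl
  ... | no p≢p = ⊥-elim (p≢p refl)

  τ-right : (p q : Dart m) → τ p q q ≡ p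
  τ-right p q with q ≟D p
  ... | yes q≡p = q≡p
  ... | no _ with q ≟D q
  ...   | yes _  = refl
  ...   | no q≢q = ⊥-elim (q≢q refl)

  τ-other : {p q z : Dart m} → z ≢ p → z ≢ q → τ p q z ≡ z
  τ-other {p} {q} {z} z≢p z≢q with z ≟D p
  ... | yes z≡p = ⊥-elim (z≢p z≡p)
  ... | no _ with z ≟D q
  ...   | yes z≡q = ⊥-elim (z≢q z≡q)
  ...   | no _    = refl

  τ-involutive : (p q z : Dart m) → τ p q (τ p q z) ≡ z
  τ-involutive p q z with z ≟D p
  ... | yes refl = τ-right z q
  ... | no z≢p with z ≟D q
  ...   | yes refl = τ-left p z
  ...   | no z≢q   = τ-other z≢p z≢q

  τ-invariant : {B : Set} (f : Dart m → B) {p q : Dart m} → f p ≡ f q → ∀ z → f (τ p q z) ≡ f z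
  τ-invariant f {p} {q} fp≡fq z with z ≟D p
  ... | yes refl = sym fp≡fq
  ... | no _ with z ≟D q
  ...   | yes refl = fp≡fq
  ...   | no _     = refl

  rev-involutive : (d : Dart m) → rev (rev d) ≡ d
  rev-involutive (_ , true)  = refl
  rev-involutive (_ , false) = refl

edge-≢ : ∀ {m} {a b : Dart m} → a ≢ b → a ≢ rev b → proj₁ a ≢ proj₁ b
edge-≢ {a = i , true}  {.i , true}  a≢b _       refl = a≢b refl
edge-≢ {a = i , true}  {.i , false} _   a≢rev-b refl = a≢rev-b refl
edge-≢ {a = i , false} {.i , true}  _   a≢rev-b refl = a≢rev-b refl
edge-≢ {a = i , false} {.i , false} a≢b _       refl = a≢b refl

merge : ∀ {n} (a b : Fin (suc n)) → a ≢ b → Fin (suc n) → Fin n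
merge a b a≢b j with j Fin.≟ b
... | yes _   = punchOut {i = b} {j = a} (a≢b ∘ sym)
... | no j≢b  = punchOut {i = b} {j = j} (j≢b ∘ sym)

OneOf : {A : Set} → A → A → A → Set
OneOf a b j = j ≡ a ⊎ j ≡ b

¬OneOf : {A : Set} {a b c : A} → c ≢ a → c ≢ b → ¬ OneOf a b c
¬OneOf c≢a c≢b (inj₁ c≡a) = c≢a c≡a
¬OneOf c≢a c≢b (inj₂ c≡b) = c≢b c≡b

OneOf? : ∀ {n} (a b c : Fin n) → Dec (OneOf a b c)
OneOf? a b c = (c Fin.≟ a) ⊎-dec (c Fin.≟ b)

module _ {n : ℕ} {a b : Fin (suc n)} (a≢b : a ≢ b) where

  merge-identifies : merge a b a≢b a ≡ merge a b a≢b b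
  merge-identifies with a Fin.≟ b | b Fin.≟ b
  ... | yes a≡b | _      = ⊥-elim (a≢b a≡b)
  ... | no _    | yes _  = punchOut-cong b refl
  ... | no _    | no b≢b = ⊥-elim (b≢b refl)

  merge-injective : ∀ i j → merge a b a≢b i ≡ merge a b a≢b j → i ≡ j ⊎ (OneOf a b i × OneOf a b j)
  merge-injective i j eq with i Fin.≟ b | j Fin.≟ b
  ... | yes i≡b | yes j≡b = inj₁ (trans i≡b (sym j≡b))
  ... | yes i≡b | no j≢b  = inj₂ (inj₂ i≡b , inj₁ (sym (punchOut-injective (a≢b ∘ sym) (j≢b ∘ sym) eq)))
  ... | no i≢b  | yes j≡b = inj₂ (inj₁ (punchOut-injective (i≢b ∘ sym) (a≢b ∘ sym) eq) , inj₂ j≡b)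
  ... | no i≢b  | no j≢b  = inj₁ (punchOut-injective (i≢b ∘ sym) (j≢b ∘ sym) eq)

  merge-surjective : ∀ t → ∃[ j ] merge a b a≢b j ≡ t
  merge-surjective t = punchIn b t , merge-punchIn
    where
      merge-punchIn : merge a b a≢b (punchIn b t) ≡ t
      merge-punchIn with punchIn b t Fin.≟ b
      ... | yes eq = ⊥-elim (punchInᵢ≢i b t eq)
      ... | no _   = trans (punchOut-cong b refl) (punchOut-punchIn b)

module _ {n : ℕ} where

  transpose-left : (i j : Fin n) → PC.transpose i j i ≡ j
  transpose-left i j with i Fin.≟ i
  ... | yes _  = refl
  ... | no i≢i = ⊥-elim (i≢i refl)

  transpose-right : (i j : Fin n) → PC.transpose i j j ≡ i
  transpose-right i j with j Fin.≟ i
  ... | yes j≡i = j≡i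
  ... | no _ with j Fin.≟ j
  ...   | yes _  = refl
  ...   | no j≢j = ⊥-elim (j≢j refl)

  transpose-other : {i j k : Fin n} → k ≢ i → k ≢ j → PC.transpose i j k ≡ k
  transpose-other {i} {j} {k} k≢i k≢j with k Fin.≟ i
  ... | yes k≡i = ⊥-elim (k≢i k≡i)
  ... | no _ with k Fin.≟ j
  ...   | yes k≡j = ⊥-elim (k≢j k≡j)
  ...   | no _    = refl

OrbitLabelling-≥2 : ∀ {m n} (G : RotSys m) {π : Dart m → Dart m} → OrbitLabelling G π n →
                    ∀ {a b} → ¬ SameOrbit π a b → 2 ≤ n
OrbitLabelling-≥2 {n = zero}        G (lab , _) {a} a≁b = ⊥-elim (¬Fin0 (lab a))
OrbitLabelling-≥2 {n = suc zero}    G (lab , _ , sameOrbit) {a} {b} a≁b =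
  ⊥-elim (a≁b (Equivalence.to (sameOrbit a b) (Fin1-unique (lab a) (lab b))))
  where
    Fin1-unique : (i j : Fin 1) → i ≡ j
    Fin1-unique Fin.zero Fin.zero = refl
OrbitLabelling-≥2 {n = suc (suc n)} G _ _ = s≤s (s≤s z≤n)

module VertexLabels {m n : ℕ} (G : RotSys m) (VL : VertexLabelling G n) where
  open RotSys G

  lab : Dart m → Fin n
  lab = proj₁ VL

  lab⇒SameVertex : ∀ {a b} → lab a ≡ lab b → SameVertex G a b
  lab⇒SameVertex = Equivalence.to (proj₂ (proj₂ VL) _ _)

  SameVertex⇒lab : ∀ {a b} → SameVertex G a b → lab a ≡ lab b
  SameVertex⇒lab = Equivalence.from (proj₂ (proj₂ VL) _ _)

  lab-σ : ∀ z → lab (σ z) ≡ lab z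
  lab-σ z = sym (SameVertex⇒lab (SameOrbit-step refl))

genus-step : ∀ n f g k → suc (suc n) + f + 2 * g ≡ k → n + f + 2 * suc g ≡ k
genus-step n f g k euler = begin
  n + f + 2 * suc g          ≡⟨ cong (n + f +_) (*-suc 2 g) ⟩
  n + f + suc (suc (2 * g))  ≡⟨ +-suc (n + f) (suc (2 * g)) ⟩
  suc (n + f + suc (2 * g))  ≡⟨ cong suc (+-suc (n + f) (2 * g)) ⟩
  suc (suc (n + f + 2 * g))  ≡⟨ euler ⟩
  k                          ∎
  where open ≡-Reasoning

module IdentifyAngles {m : ℕ} (G : RotSys m) (perm : IsPermutation G) (p q : Dart m) where
  open RotSys G

  G′ : RotSys m
  G′ = identifyAngles G p q

  σ′ : Dart m → Dart m
  σ′ = RotSys.σ G′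

  σ′-left : σ′ p ≡ σ q
  σ′-left = cong σ (τ-left p q)

  σ′-right : σ′ q ≡ σ p
  σ′-right = cong σ (τ-right p q)

  σ′-other : ∀ {z} → z ≢ p → z ≢ q → σ′ z ≡ σ z
  σ′-other z≢p z≢q = cong σ (τ-other z≢p z≢q)

  isPermutation : IsPermutation G′
  isPermutation = (λ z → trans (cong σ (τ-involutive p q (σ⁻ z))) (proj₁ perm z))
                , (λ z → trans (cong (τ p q) (proj₂ perm (τ p q z))) (τ-involutive p q z))

  module Merge {n : ℕ} (VL : VertexLabelling G (suc n)) (p≁q : proj₁ VL p ≢ proj₁ VL q) where

    open VertexLabels G VL public

    label′ : Dart m → Fin n
    label′ = merge (lab p) (lab q) p≁q ∘ lab

    label′-σ′ : ∀ z → label′ (σ′ z) ≡ label′ z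
    label′-σ′ z = trans (cong (merge (lab p) (lab q) p≁q) (lab-σ (τ p q z)))
                        (τ-invariant label′ (merge-identifies p≁q) z)

    σ′-agrees : ∀ {s z} → OneOf p q s → lab z ≡ lab s → z ≢ s → σ′ z ≡ σ z
    σ′-agrees (inj₁ refl) eq z≢p = σ′-other z≢p (λ { refl → p≁q (sym eq) })
    σ′-agrees (inj₂ refl) eq z≢q = σ′-other (λ { refl → p≁q eq }) z≢q

    σ′-returns : ∀ {s} → OneOf p q s → SameVertex G′ (σ s) s
    σ′-returns {s} s∈pq = SameOrbit-agree _≟D_ (λ z → lab z ≡ lab s) (λ z eq → trans (lab-σ z) eq)
                            (λ z → σ′-agrees s∈pq) (lab-σ s) (lab⇒SameVertex (lab-σ s))

    σ′-visits-σ : ∀ z → SameVertex G′ z (σ z)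
    σ′-visits-σ z with z ≟D p | z ≟D q
    ... | yes refl | _        = SameOrbit-trans (SameOrbit-step σ′-left)
                                  (SameOrbit-trans (σ′-returns (inj₂ refl)) (SameOrbit-step σ′-right))
    ... | no _     | yes refl = SameOrbit-trans (SameOrbit-step σ′-right)
                                  (SameOrbit-trans (σ′-returns (inj₁ refl)) (SameOrbit-step σ′-left))
    ... | no z≢p   | no z≢q   = SameOrbit-step (σ′-other z≢p z≢q)

    SameVertex⇒SameVertex′ : ∀ {a b} → SameVertex G a b → SameVertex G′ a b
    SameVertex⇒SameVertex′ = SameOrbit-mono σ′-visits-σ

    lab⇒SameVertex′ : ∀ {a b} → lab a ≡ lab b → SameVertex G′ a b
    lab⇒SameVertex′ = SameVertex⇒SameVertex′ ∘ lab⇒SameVertex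

    p∼q : SameVertex G′ p q
    p∼q = SameOrbit-trans (SameOrbit-step σ′-left) (lab⇒SameVertex′ (lab-σ q))

    q∼p : SameVertex G′ q p
    q∼p = SameOrbit-trans (SameOrbit-step σ′-right) (lab⇒SameVertex′ (lab-σ p))

    OnMerged : Dart m → Set
    OnMerged z = OneOf (lab p) (lab q) (lab z)

    OnMerged⇒∼p : ∀ {z} → OnMerged z → SameVertex G′ z p
    OnMerged⇒∼p (inj₁ eq) = lab⇒SameVertex′ eq
    OnMerged⇒∼p (inj₂ eq) = SameOrbit-trans (lab⇒SameVertex′ eq) q∼p

    p∼OnMerged : ∀ {z} → OnMerged z → SameVertex G′ p z
    p∼OnMerged (inj₁ eq) = lab⇒SameVertex′ (sym eq)
    p∼OnMerged (inj₂ eq) = SameOrbit-trans p∼q (lab⇒SameVertex′ (sym eq))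

    SameVertex′⇒ : ∀ {a b} → SameVertex G′ a b → lab a ≡ lab b ⊎ (OnMerged a × OnMerged b)
    SameVertex′⇒ = merge-injective p≁q _ _ ∘ SameOrbit-invariant label′ label′-σ′

    label′⇒SameVertex′ : ∀ {a b} → label′ a ≡ label′ b → SameVertex G′ a b
    label′⇒SameVertex′ eq with merge-injective p≁q _ _ eq
    ... | inj₁ lab-a≡lab-b           = lab⇒SameVertex′ lab-a≡lab-b
    ... | inj₂ (a-merged , b-merged) = SameOrbit-trans (OnMerged⇒∼p a-merged) (p∼OnMerged b-merged)

    vertexLabelling : VertexLabelling G′ n
    vertexLabelling = label′ , surjective , λ a b → mk⇔ label′⇒SameVertex′ (SameOrbit-invariant label′ label′-σ′)
      where
        surjective : ∀ i → ∃[ x ] label′ x ≡ i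
        surjective i with merge-surjective p≁q i
        ... | j , merge-j≡i with proj₁ (proj₂ VL) j
        ...   | x , lab-x≡j = x , trans (cong (merge (lab p) (lab q) p≁q) lab-x≡j) merge-j≡i

    connected : Connected G → Connected G′
    connected conn a b = lift (conn a b)
      where
        lift : ∀ {x y} → Star (Step G) x y → Star (Step G′) x y
        lift ε                  = ε
        lift (inj₁ refl ◅ path) = SameOrbit⇒Star (λ _ → inj₁ refl) (σ′-visits-σ _) ◅◅ lift path
        lift (inj₂ eq   ◅ path) = inj₂ eq ◅ lift path

UPairEq-orient : ∀ {n} (f g : Bool → Fin n) b b′ → f b ≡ g b′ → f (not b) ≡ g (not b′) →
                 UPairEq (f true , f false) (g true , g false)
UPairEq-orient f g true  true  eq eq′ = inj₁ (eq , eq′)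
UPairEq-orient f g true  false eq eq′ = inj₂ (eq , eq′)
UPairEq-orient f g false true  eq eq′ = inj₂ (eq′ , eq)
UPairEq-orient f g false false eq eq′ = inj₁ (eq′ , eq)

module ConjugateFaces {m m′ : ℕ} (G : RotSys m) (H : RotSys m′) (κ : Dart m ↔ Dart m′)
                      (κ-conj : ∀ d → φ H (Inverse.to κ d) ≡ Inverse.to κ (φ G d)) where
  open Inverse κ using (to; from; strictlyInverseˡ; strictlyInverseʳ)

  κ⁻¹-conj : ∀ d → φ G (from d) ≡ from (φ H d)
  κ⁻¹-conj d = begin
    φ G (from d)             ≡⟨ sym (strictlyInverseʳ _) ⟩
    from (to (φ G (from d))) ≡⟨ cong from (sym (κ-conj (from d))) ⟩
    from (φ H (to (from d))) ≡⟨ cong (from ∘ φ H) (strictlyInverseˡ d) ⟩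
    from (φ H d)             ∎
    where open ≡-Reasoning

  κ-preserves-faces : ∀ {a b} → SameOrbit (φ G) a b → SameOrbit (φ H) (to a) (to b)
  κ-preserves-faces = SameOrbit-conjugate to κ-conj

  κ⁻¹-preserves-faces : ∀ {a b} → SameOrbit (φ H) a b → SameOrbit (φ G) (from a) (from b)
  κ⁻¹-preserves-faces = SameOrbit-conjugate from κ⁻¹-conj

  faceLabelling : ∀ {f} → FaceLabelling G f → FaceLabelling H f
  faceLabelling (lab , surjective , sameFace) =
    lab ∘ from ,
    (λ i → to (proj₁ (surjective i)) , trans (cong lab (strictlyInverseʳ _)) (proj₂ (surjective i))) ,
    λ a b → mk⇔ (λ eq → subst₂ (SameOrbit (φ H)) (strictlyInverseˡ a) (strictlyInverseˡ b)
                                  (κ-preserves-faces (Equivalence.to (sameFace _ _) eq)))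
                (Equivalence.from (sameFace _ _) ∘ κ⁻¹-preserves-faces)

  OnSameFaceH : Dart m′ → Dart m′ → Set
  OnSameFaceH a b = SameOrbit (φ H) a b ⊎ SameOrbit (φ H) b a

  EdgeMatch : (Fin m → Fin m′) → Fin m → Set
  EdgeMatch χ e = ∃[ d ] ∃[ t ] proj₁ d ≡ e × proj₁ t ≡ χ e ×
                    OnSameFaceH (to d) t × OnSameFaceH (to (rev d)) (rev t)

  dual-≅ : (χ : Fin m ↔ Fin m′) → (∀ e → EdgeMatch (Inverse.to χ) e) → DualsIsomorphic G H
  dual-≅ χ match {f} {f′} (labG , surjG , sameFaceG) (labH , surjH , sameFaceH) = ψ , χ , edge
    where
      repG : Fin f → Dart m
      repG i = proj₁ (surjG i)

      repH : Fin f′ → Dart m′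
      repH j = proj₁ (surjH j)

      OnSameFaceH⇒lab : ∀ {a b} → OnSameFaceH a b → labH a ≡ labH b
      OnSameFaceH⇒lab (inj₁ a∼b) = Equivalence.from (sameFaceH _ _) a∼b
      OnSameFaceH⇒lab (inj₂ b∼a) = sym (Equivalence.from (sameFaceH _ _) b∼a)

      labG⇒labH : ∀ {a b} → labG a ≡ labG b → labH (to a) ≡ labH (to b)
      labG⇒labH eq = Equivalence.from (sameFaceH _ _) (κ-preserves-faces (Equivalence.to (sameFaceG _ _) eq))

      labH⇒labG : ∀ {a b} → labH a ≡ labH b → labG (from a) ≡ labG (from b)
      labH⇒labG eq = Equivalence.from (sameFaceG _ _) (κ⁻¹-preserves-faces (Equivalence.to (sameFaceH _ _) eq))

      ψ→ : Fin f → Fin f′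
      ψ→ i = labH (to (repG i))

      ψ← : Fin f′ → Fin f
      ψ← j = labG (from (repH j))

      ψ : Fin f ↔ Fin f′
      ψ = mk↔ₛ′ ψ→ ψ←
        (λ j → trans (labG⇒labH (proj₂ (surjG _))) (trans (cong labH (strictlyInverseˡ _)) (proj₂ (surjH j))))
        (λ i → trans (labH⇒labG (proj₂ (surjH _))) (trans (cong labG (strictlyInverseʳ _)) (proj₂ (surjG i))))

      ψ-lab : ∀ d → ψ→ (labG d) ≡ labH (to d)
      ψ-lab d = labG⇒labH (proj₂ (surjG (labG d)))

      edge : ∀ e → UPairEq (ψ→ (labG (e , true)) , ψ→ (labG (e , false)))
                           (labH (Inverse.to χ e , true) , labH (Inverse.to χ e , false))
      edge e with match e
      ... | (_ , b) , (_ , b′) , refl , refl , side , side′ =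
        UPairEq-orient (λ c → ψ→ (labG (e , c))) (λ c → labH (Inverse.to χ e , c)) b b′
          (trans (ψ-lab _) (OnSameFaceH⇒lab side)) (trans (ψ-lab _) (OnSameFaceH⇒lab side′))

module HOperation {m : ℕ} (G : RotSys m) (e : Fin m) where
  open RotSys G
  open HData G e

  p₁ q₁ : Dart m
  p₁ = σ⁻ dvx
  q₁ = σ⁻ dv'y

  H : RotSys m
  H = Hop G e

  σH : Dart m → Dart m
  σH = RotSys.σ H

  module Properties (perm : IsPermutation G) {n : ℕ} (VL : VertexLabelling G (suc (suc n)))
    (noLoops : NoLoops G) (noMultiEdges : NoMultiEdges G) (minDeg : MinDegree≥2 G)
    (deg-x : HasDegree G dx 3) (deg-y : HasDegree G dy 3)
    (v≁w′ : ¬ SameVertex G nv nw') (v≁w : ¬ SameVertex G nv nw) (v≁v′ : ¬ SameVertex G nv nv')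
    (w′≁w : ¬ SameVertex G nw' nw) (w′≁v′ : ¬ SameVertex G nw' nv') (w≁v′ : ¬ SameVertex G nw nv')
    where
    open VertexLabels G VL

    σ∘σ⁻ : ∀ z → σ (σ⁻ z) ≡ z
    σ∘σ⁻ = proj₁ perm

    σ-injective : ∀ {a b} → σ a ≡ σ b → a ≡ b
    σ-injective {a} {b} eq = trans (sym (proj₂ perm a)) (trans (cong σ⁻ eq) (proj₂ perm b))

    rev-swap : ∀ {a b : Dart m} → rev a ≡ b → a ≡ rev b
    rev-swap {a} eq = trans (sym (rev-involutive a)) (cong rev eq)

    lab-σσ : ∀ z → lab (σ (σ z)) ≡ lab z
    lab-σσ z = trans (lab-σ (σ z)) (lab-σ z)

    lab-σ⁻ : ∀ z → lab (σ⁻ z) ≡ lab z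
    lab-σ⁻ z = trans (sym (lab-σ (σ⁻ z))) (cong lab (σ∘σ⁻ z))

    ≢-by-labels : ∀ {a b A B} → lab a ≡ A → lab b ≡ B → A ≢ B → a ≢ b
    ≢-by-labels refl refl A≢B refl = A≢B refl

    Lx Ly Lv Lv′ Lw Lw′ : Fin (suc (suc n))
    Lx  = lab dx
    Ly  = lab dy
    Lv  = lab dvx
    Lv′ = lab dv'y
    Lw  = lab dwy
    Lw′ = lab dw'x

    σdx≢dx : σ dx ≢ dx
    σdx≢dx = minDeg dx

    σdy≢dy : σ dy ≢ dy
    σdy≢dy = minDeg dy

    σσdx≢dx : σ (σ dx) ≢ dx
    σσdx≢dx = proj₂ deg-x 2 (s≤s z≤n) (s≤s (s≤s (s≤s z≤n)))

    σσdy≢dy : σ (σ dy) ≢ dy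
    σσdy≢dy = proj₂ deg-y 2 (s≤s z≤n) (s≤s (s≤s (s≤s z≤n)))

    x≢y : Lx ≢ Ly
    x≢y = noLoops dx ∘ lab⇒SameVertex

    x≢v : Lx ≢ Lv
    x≢v = noLoops (σ (σ dx)) ∘ lab⇒SameVertex ∘ trans (lab-σσ dx)

    x≢w′ : Lx ≢ Lw′
    x≢w′ = noLoops (σ dx) ∘ lab⇒SameVertex ∘ trans (lab-σ dx)

    y≢w : Ly ≢ Lw
    y≢w = noLoops (σ dy) ∘ lab⇒SameVertex ∘ trans (lab-σ dy)

    y≢v′ : Ly ≢ Lv′
    y≢v′ = noLoops (σ (σ dy)) ∘ lab⇒SameVertex ∘ trans (lab-σσ dy)

    x≢w : Lx ≢ Lw
    x≢w eq = σdy≢dy (sym (noMultiEdges dy (σ dy) (SameOrbit-step refl) (lab⇒SameVertex eq)))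

    x≢v′ : Lx ≢ Lv′
    x≢v′ eq = σσdy≢dy (sym (noMultiEdges dy (σ (σ dy)) (2 , refl) (lab⇒SameVertex eq)))

    y≢w′ : Ly ≢ Lw′
    y≢w′ eq = σdx≢dx (sym (noMultiEdges dx (σ dx) (SameOrbit-step refl) (lab⇒SameVertex eq)))

    y≢v : Ly ≢ Lv
    y≢v eq = σσdx≢dx (sym (noMultiEdges dx (σ (σ dx)) (2 , refl) (lab⇒SameVertex eq)))

    v≢w′ : Lv ≢ Lw′
    v≢w′ = v≁w′ ∘ lab⇒SameVertex

    v≢w : Lv ≢ Lw
    v≢w = v≁w ∘ lab⇒SameVertex

    v≢v′ : Lv ≢ Lv′
    v≢v′ = v≁v′ ∘ lab⇒SameVertex

    w′≢w : Lw′ ≢ Lw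
    w′≢w = w′≁w ∘ lab⇒SameVertex

    w′≢v′ : Lw′ ≢ Lv′
    w′≢v′ = w′≁v′ ∘ lab⇒SameVertex

    w≢v′ : Lw ≢ Lv′
    w≢v′ = w≁v′ ∘ lab⇒SameVertex

    p₁≁q₁ : lab p₁ ≢ lab q₁
    p₁≁q₁ eq = v≢v′ (trans (sym (lab-σ⁻ dvx)) (trans eq (lab-σ⁻ dv'y)))

    module I₁ = IdentifyAngles G perm p₁ q₁
    module M₁ = I₁.Merge VL p₁≁q₁

    G₁ : RotSys m
    G₁ = I₁.G′

    AtV AtW AtXY : Dart m → Set
    AtV  z = OneOf Lv Lv′ (lab z)
    AtW  z = OneOf Lw Lw′ (lab z)
    AtXY z = OneOf Lx Ly (lab z)

    merged₁⇒AtV : ∀ {z} → M₁.OnMerged z → AtV z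
    merged₁⇒AtV (inj₁ eq) = inj₁ (trans eq (lab-σ⁻ dvx))
    merged₁⇒AtV (inj₂ eq) = inj₂ (trans eq (lab-σ⁻ dv'y))

    AtV⇒merged₁ : ∀ {z} → AtV z → M₁.OnMerged z
    AtV⇒merged₁ (inj₁ eq) = inj₁ (trans eq (sym (lab-σ⁻ dvx)))
    AtV⇒merged₁ (inj₂ eq) = inj₂ (trans eq (sym (lab-σ⁻ dv'y)))

    SameVertex₁⇒ : ∀ {a b} → SameVertex G₁ a b → lab a ≡ lab b ⊎ (AtV a × AtV b)
    SameVertex₁⇒ a∼b with M₁.SameVertex′⇒ a∼b
    ... | inj₁ eq             = inj₁ eq
    ... | inj₂ (a-at , b-at) = inj₂ (merged₁⇒AtV a-at , merged₁⇒AtV b-at)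

    w≁w′-in-G₁ : M₁.label′ dwy ≢ M₁.label′ dw'x
    w≁w′-in-G₁ eq with SameVertex₁⇒ (M₁.label′⇒SameVertex′ eq)
    ... | inj₁ w≡w′       = w′≢w (sym w≡w′)
    ... | inj₂ (w-at-v , _) = ¬OneOf (≢-sym v≢w) w≢v′ w-at-v

    module I₂ = IdentifyAngles G₁ I₁.isPermutation dwy dw'x
    module M₂ = I₂.Merge M₁.vertexLabelling w≁w′-in-G₁

    p₁≢dwy : p₁ ≢ dwy
    p₁≢dwy = ≢-by-labels (lab-σ⁻ dvx) refl v≢w

    p₁≢dw'x : p₁ ≢ dw'x
    p₁≢dw'x = ≢-by-labels (lab-σ⁻ dvx) refl v≢w′

    q₁≢dwy : q₁ ≢ dwy
    q₁≢dwy = ≢-by-labels (lab-σ⁻ dv'y) refl (≢-sym w≢v′)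

    q₁≢dw'x : q₁ ≢ dw'x
    q₁≢dw'x = ≢-by-labels (lab-σ⁻ dv'y) refl (≢-sym w′≢v′)

    σH-other : ∀ {z} → z ≢ p₁ → z ≢ q₁ → z ≢ dwy → z ≢ dw'x → σH z ≡ σ z
    σH-other z≢p₁ z≢q₁ z≢dwy z≢dw'x = trans (I₂.σ′-other z≢dwy z≢dw'x) (I₁.σ′-other z≢p₁ z≢q₁)

    σH-unmerged : ∀ {z} → ¬ AtV z → ¬ AtW z → σH z ≡ σ z
    σH-unmerged z∉V z∉W =
      σH-other (λ { refl → z∉V (inj₁ (lab-σ⁻ dvx)) }) (λ { refl → z∉V (inj₂ (lab-σ⁻ dv'y)) })
               (λ { refl → z∉W (inj₁ refl) }) (λ { refl → z∉W (inj₂ refl) })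

    ¬AtV-x : ∀ {z} → lab z ≡ Lx → ¬ AtV z
    ¬AtV-x at-x rewrite at-x = ¬OneOf x≢v x≢v′

    ¬AtW-x : ∀ {z} → lab z ≡ Lx → ¬ AtW z
    ¬AtW-x at-x rewrite at-x = ¬OneOf x≢w x≢w′

    ¬AtV-y : ∀ {z} → lab z ≡ Ly → ¬ AtV z
    ¬AtV-y at-y rewrite at-y = ¬OneOf y≢v y≢v′

    ¬AtW-y : ∀ {z} → lab z ≡ Ly → ¬ AtW z
    ¬AtW-y at-y rewrite at-y = ¬OneOf y≢w y≢w′

    σH-at-x : ∀ {z} → lab z ≡ Lx → σH z ≡ σ z
    σH-at-x at-x = σH-unmerged (¬AtV-x at-x) (¬AtW-x at-x)

    σH-at-y : ∀ {z} → lab z ≡ Ly → σH z ≡ σ z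
    σH-at-y at-y = σH-unmerged (¬AtV-y at-y) (¬AtW-y at-y)

    σH-p₁ : σH p₁ ≡ dv'y
    σH-p₁ = trans (I₂.σ′-other p₁≢dwy p₁≢dw'x) (trans I₁.σ′-left (σ∘σ⁻ dv'y))

    σH-q₁ : σH q₁ ≡ dvx
    σH-q₁ = trans (I₂.σ′-other q₁≢dwy q₁≢dw'x) (trans I₁.σ′-right (σ∘σ⁻ dvx))

    σH-dwy : σH dwy ≡ σ dw'x
    σH-dwy = trans I₂.σ′-left (I₁.σ′-other (≢-sym p₁≢dw'x) (≢-sym q₁≢dw'x))

    σH-dw'x : σH dw'x ≡ σ dwy
    σH-dw'x = trans I₂.σ′-right (I₁.σ′-other (≢-sym p₁≢dwy) (≢-sym q₁≢dwy))

    lab⇒SameVertexH : ∀ {a b} → lab a ≡ lab b → SameVertex H a b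
    lab⇒SameVertexH = M₂.SameVertex⇒SameVertex′ ∘ M₁.lab⇒SameVertex′

    AtV⇒SameVertexH : ∀ {a b} → AtV a → AtV b → SameVertex H a b
    AtV⇒SameVertexH a-at b-at = M₂.SameVertex⇒SameVertex′
      (SameOrbit-trans (M₁.OnMerged⇒∼p (AtV⇒merged₁ a-at)) (M₁.p∼OnMerged (AtV⇒merged₁ b-at)))

    AtW⇒SameVertexH : ∀ {a b} → AtW a → AtW b → SameVertex H a b
    AtW⇒SameVertexH a-at b-at =
      SameOrbit-trans (M₂.OnMerged⇒∼p (merged a-at)) (M₂.p∼OnMerged (merged b-at))
      where
        merged : ∀ {z} → AtW z → M₂.OnMerged z
        merged (inj₁ eq) = inj₁ (cong (merge (lab p₁) (lab q₁) p₁≁q₁) eq)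
        merged (inj₂ eq) = inj₂ (cong (merge (lab p₁) (lab q₁) p₁≁q₁) eq)

    SameVertexH⇒ : ∀ {a b} → SameVertex H a b → lab a ≡ lab b ⊎ (AtV a × AtV b) ⊎ (AtW a × AtW b)
    SameVertexH⇒ a∼b with M₂.SameVertex′⇒ a∼b
    ... | inj₁ eq with SameVertex₁⇒ (M₁.label′⇒SameVertex′ eq)
    ...   | inj₁ eq′ = inj₁ eq′
    ...   | inj₂ V   = inj₂ (inj₁ V)
    SameVertexH⇒ a∼b | inj₂ (a-at , b-at) = inj₂ (inj₂ (merged₂⇒AtW a-at , merged₂⇒AtW b-at))
      where
        merged₂⇒AtW : ∀ {z} → M₂.OnMerged z → AtW z
        merged₂⇒AtW (inj₁ eq) with SameVertex₁⇒ (M₁.label′⇒SameVertex′ eq)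
        ... | inj₁ at-w      = inj₁ at-w
        ... | inj₂ (_ , w-at-v) = ⊥-elim (¬OneOf (≢-sym v≢w) w≢v′ w-at-v)
        merged₂⇒AtW (inj₂ eq) with SameVertex₁⇒ (M₁.label′⇒SameVertex′ eq)
        ... | inj₁ at-w′      = inj₂ at-w′
        ... | inj₂ (_ , w′-at-v) = ⊥-elim (¬OneOf (≢-sym v≢w′) w′≢v′ w′-at-v)

    ¬SameVertexH : ∀ {a b} → lab a ≢ lab b → ¬ (AtV a × AtV b) → ¬ (AtW a × AtW b) → ¬ SameVertex H a b
    ¬SameVertexH a≢b ¬V ¬W a∼b with SameVertexH⇒ a∼b
    ... | inj₁ eq        = a≢b eq
    ... | inj₂ (inj₁ V) = ¬V V
    ... | inj₂ (inj₂ W) = ¬W W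

    ¬AtV-w : ¬ AtV dwy
    ¬AtV-w = ¬OneOf (≢-sym v≢w) w≢v′

    ¬AtW-v : ¬ AtW dvx
    ¬AtW-v = ¬OneOf v≢w v≢w′

    v∼ᴴv′ : SameVertex H dvx dv'y
    v∼ᴴv′ = AtV⇒SameVertexH (inj₁ refl) (inj₂ refl)

    w∼ᴴw′ : SameVertex H dwy dw'x
    w∼ᴴw′ = AtW⇒SameVertexH (inj₁ refl) (inj₂ refl)

    Outside : Dart m → Set
    Outside z = ¬ SameVertex H dvx z × ¬ SameVertex H dwy z

    OutsideStep : Dart m → Dart m → Set
    OutsideStep a b = Outside a × Outside b × Step H a b

    -- x and y have degree 3, and their edges other than xy lead to v, w′ and w, v′.
    OutsideStep-AtXY : ∀ {a b} → AtXY a → OutsideStep a b → AtXY b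
    OutsideStep-AtXY (inj₁ at-x) (_ , _ , inj₁ refl) = inj₁ (trans (cong lab (σH-at-x at-x)) (trans (lab-σ _) at-x))
    OutsideStep-AtXY (inj₂ at-y) (_ , _ , inj₁ refl) = inj₂ (trans (cong lab (σH-at-y at-y)) (trans (lab-σ _) at-y))
    OutsideStep-AtXY (inj₁ at-x) (_ , (v≁b , w≁b) , inj₂ refl)
      with SameOrbit-period-3 (proj₁ deg-x) (lab⇒SameVertex (sym at-x))
    ... | inj₁ refl        = inj₂ refl
    ... | inj₂ (inj₁ refl) = ⊥-elim (w≁b w∼ᴴw′)
    ... | inj₂ (inj₂ refl) = ⊥-elim (v≁b SameOrbit-refl)
    OutsideStep-AtXY (inj₂ at-y) (_ , (v≁b , w≁b) , inj₂ refl)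
      with SameOrbit-period-3 (proj₁ deg-y) (lab⇒SameVertex (sym at-y))
    ... | inj₁ refl        = inj₁ refl
    ... | inj₂ (inj₁ refl) = ⊥-elim (w≁b SameOrbit-refl)
    ... | inj₂ (inj₂ refl) = ⊥-elim (v≁b v∼ᴴv′)

    Star-AtXY : ∀ {a b} → AtXY a → Star OutsideStep a b → AtXY b
    Star-AtXY a-at ε           = a-at
    Star-AtXY a-at (s ◅ path) = Star-AtXY (OutsideStep-AtXY a-at s) path

    twoCut-from : ∀ z → ¬ AtXY z → ¬ AtV z → ¬ AtW z → HasTwoCut H
    twoCut-from z z∉XY z∉V z∉W =
      dvx , dwy , v≁ᴴw , dx , z , (v≁ᴴx , w≁ᴴx) , (v≁ᴴz , w≁ᴴz) , λ path → z∉XY (Star-AtXY (inj₁ refl) path)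
      where
        v≁ᴴw : ¬ SameVertex H dvx dwy
        v≁ᴴw = ¬SameVertexH v≢w (¬AtV-w ∘ proj₂) (¬AtW-v ∘ proj₁)

        v≁ᴴx : ¬ SameVertex H dvx dx
        v≁ᴴx = ¬SameVertexH (≢-sym x≢v) (¬AtV-x refl ∘ proj₂) (¬AtW-v ∘ proj₁)

        w≁ᴴx : ¬ SameVertex H dwy dx
        w≁ᴴx = ¬SameVertexH (≢-sym x≢w) (¬AtV-w ∘ proj₁) (¬AtW-x refl ∘ proj₂)

        v≁ᴴz : ¬ SameVertex H dvx z
        v≁ᴴz = ¬SameVertexH (λ eq → z∉V (inj₁ (sym eq))) (z∉V ∘ proj₂) (¬AtW-v ∘ proj₁)

        w≁ᴴz : ¬ SameVertex H dwy z
        w≁ᴴz = ¬SameVertexH (λ eq → z∉W (inj₁ (sym eq))) (¬AtV-w ∘ proj₁) (z∉W ∘ proj₂)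

    Position : Dart m → Set
    Position z = AtXY z ⊎ AtV z ⊎ AtW z ⊎ (¬ AtXY z × ¬ AtV z × ¬ AtW z)

    position : ∀ z → Position z
    position z with OneOf? Lx Ly (lab z) | OneOf? Lv Lv′ (lab z) | OneOf? Lw Lw′ (lab z)
    ... | yes at-xy | _        | _        = inj₁ at-xy
    ... | no _      | yes at-v | _        = inj₂ (inj₁ at-v)
    ... | no _      | no _     | yes at-w = inj₂ (inj₂ (inj₁ at-w))
    ... | no ∉XY    | no ∉V    | no ∉W    = inj₂ (inj₂ (inj₂ (∉XY , ∉V , ∉W)))

    lab-rev-dvx : lab (rev dvx) ≡ Lx
    lab-rev-dvx = trans (cong lab (rev-involutive (σ (σ dx)))) (lab-σσ dx)

    lab-rev-dv'y : lab (rev dv'y) ≡ Ly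
    lab-rev-dv'y = trans (cong lab (rev-involutive (σ (σ dy)))) (lab-σσ dy)

    ¬parallel-σ⁻ : ∀ d → ¬ SameVertex G (rev (σ⁻ d)) (rev d)
    ¬parallel-σ⁻ d heads = minDeg (σ⁻ d) (trans (σ∘σ⁻ d) (sym σ⁻d≡d))
      where
        σ⁻d≡d : σ⁻ d ≡ d
        σ⁻d≡d = noMultiEdges (σ⁻ d) d (lab⇒SameVertex (lab-σ⁻ d)) heads

    -- rev p₁ and rev q₁ point to the paper's a₁ and b₁.
    module _ (noLoopsH : NoLoops H) (noMultiEdgesH : NoMultiEdges H) where

      a₁≢x : lab (rev p₁) ≢ Lx
      a₁≢x at-x = ¬parallel-σ⁻ dvx (lab⇒SameVertex (trans at-x (sym lab-rev-dvx)))

      b₁≢y : lab (rev q₁) ≢ Ly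
      b₁≢y at-y = ¬parallel-σ⁻ dv'y (lab⇒SameVertex (trans at-y (sym lab-rev-dv'y)))

      a₁≢y : lab (rev p₁) ≢ Ly
      a₁≢y at-y = v≢v′ (trans (sym (lab-σ⁻ dvx)) (cong lab p₁≡dv'y))
        where
          p₁≡dv'y : p₁ ≡ dv'y
          p₁≡dv'y = rev-swap (noMultiEdgesH (rev p₁) (σ (σ dy))
            (lab⇒SameVertexH (trans at-y (sym (lab-σσ dy))))
            (subst (λ t → SameVertex H t dv'y) (sym (rev-involutive p₁)) (SameOrbit-step σH-p₁)))

      b₁≢x : lab (rev q₁) ≢ Lx
      b₁≢x at-x = v≢v′ (sym (trans (sym (lab-σ⁻ dv'y)) (cong lab q₁≡dvx)))
        where
          q₁≡dvx : q₁ ≡ dvx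
          q₁≡dvx = rev-swap (noMultiEdgesH (rev q₁) (σ (σ dx))
            (lab⇒SameVertexH (trans at-x (sym (lab-σσ dx))))
            (subst (λ t → SameVertex H t dvx) (sym (rev-involutive q₁)) (SameOrbit-step σH-q₁)))

      twoCut : HasTwoCut H
      twoCut with position (rev p₁)
      ... | inj₂ (inj₂ (inj₂ (∉XY , ∉V , ∉W))) = twoCut-from (rev p₁) ∉XY ∉V ∉W
      ... | inj₁ (inj₁ at-x)                    = ⊥-elim (a₁≢x at-x)
      ... | inj₁ (inj₂ at-y)                    = ⊥-elim (a₁≢y at-y)
      ... | inj₂ (inj₁ (inj₁ at-v))             =
        ⊥-elim (noLoops p₁ (lab⇒SameVertex (trans (lab-σ⁻ dvx) (sym at-v))))
      ... | inj₂ (inj₁ (inj₂ at-v′))            =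
        ⊥-elim (noLoopsH p₁ (AtV⇒SameVertexH (inj₁ (lab-σ⁻ dvx)) (inj₂ at-v′)))
      ... | inj₂ (inj₂ (inj₁ a₁-at-w)) with position (rev q₁)
      ...   | inj₂ (inj₂ (inj₂ (∉XY , ∉V , ∉W))) = twoCut-from (rev q₁) ∉XY ∉V ∉W
      ...   | inj₁ (inj₁ at-x)                    = ⊥-elim (b₁≢x at-x)
      ...   | inj₁ (inj₂ at-y)                    = ⊥-elim (b₁≢y at-y)
      ...   | inj₂ (inj₁ (inj₁ at-v))             =
        ⊥-elim (noLoopsH q₁ (AtV⇒SameVertexH (inj₂ (lab-σ⁻ dv'y)) (inj₁ at-v)))
      ...   | inj₂ (inj₁ (inj₂ at-v′))            =
        ⊥-elim (noLoops q₁ (lab⇒SameVertex (trans (lab-σ⁻ dv'y) (sym at-v′))))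
      ...   | inj₂ (inj₂ (inj₁ b₁-at-w))          =
        ⊥-elim (p₁≁q₁ (cong lab (noMultiEdgesH p₁ q₁
          (AtV⇒SameVertexH (inj₁ (lab-σ⁻ dvx)) (inj₂ (lab-σ⁻ dv'y)))
          (AtW⇒SameVertexH a₁-at-w b₁-at-w))))

    -- In vertex notation κ reverses xy and exchanges v→x with v′→y and y→w with x→w′.
    κ₀ κ₀⁻¹ : Dart m → Dart m
    κ₀   z = τ dvx dv'y (τ dx dy (τ (σ dy) (σ dx) z))
    κ₀⁻¹ z = τ (σ dy) (σ dx) (τ dx dy (τ dvx dv'y z))

    κ : Dart m ↔ Dart m
    κ = mk↔ₛ′ κ₀ κ₀⁻¹
      (λ z → trans (cong (τ dvx dv'y) (trans (cong (τ dx dy) (τ-involutive (σ dy) (σ dx) (τ dx dy (τ dvx dv'y z))))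
                                             (τ-involutive dx dy (τ dvx dv'y z))))
                   (τ-involutive dvx dv'y z))
      (λ z → trans (cong (τ (σ dy) (σ dx)) (trans (cong (τ dx dy) (τ-involutive dvx dv'y (τ dx dy (τ (σ dy) (σ dx) z))))
                                                  (τ-involutive dx dy (τ (σ dy) (σ dx) z))))
                   (τ-involutive (σ dy) (σ dx) z))

    κ-through : ∀ {z} → z ≢ σ dy → z ≢ σ dx → z ≢ dx → z ≢ dy → κ₀ z ≡ τ dvx dv'y z
    κ-through z≢σdy z≢σdx z≢dx z≢dy = cong (τ dvx dv'y) (trans (cong (τ dx dy) (τ-other z≢σdy z≢σdx)) (τ-other z≢dx z≢dy))

    κ-other : ∀ {z} → z ≢ σ dy → z ≢ σ dx → z ≢ dx → z ≢ dy → z ≢ dvx → z ≢ dv'y → κ₀ z ≡ z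
    κ-other z≢σdy z≢σdx z≢dx z≢dy z≢dvx z≢dv'y = trans (κ-through z≢σdy z≢σdx z≢dx z≢dy) (τ-other z≢dvx z≢dv'y)

    κ-unmerged : ∀ {z} → ¬ AtXY z → ¬ AtV z → κ₀ z ≡ z
    κ-unmerged z∉XY z∉V =
      κ-other (λ { refl → z∉XY (inj₂ (lab-σ dy)) }) (λ { refl → z∉XY (inj₁ (lab-σ dx)) })
              (λ { refl → z∉XY (inj₁ refl) }) (λ { refl → z∉XY (inj₂ refl) })
              (λ { refl → z∉V (inj₁ refl) }) (λ { refl → z∉V (inj₂ refl) })

    κ-dvx : κ₀ dvx ≡ dv'y
    κ-dvx = trans (κ-through (≢-by-labels refl (lab-σ dy) (≢-sym y≢v)) (≢-by-labels refl (lab-σ dx) (≢-sym x≢v))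
                             (≢-by-labels refl refl (≢-sym x≢v)) (≢-by-labels refl refl (≢-sym y≢v)))
                  (τ-left dvx dv'y)

    κ-dv'y : κ₀ dv'y ≡ dvx
    κ-dv'y = trans (κ-through (≢-by-labels refl (lab-σ dy) (≢-sym y≢v′)) (≢-by-labels refl (lab-σ dx) (≢-sym x≢v′))
                              (≢-by-labels refl refl (≢-sym x≢v′)) (≢-by-labels refl refl (≢-sym y≢v′)))
                   (τ-right dvx dv'y)

    κ-dx : κ₀ dx ≡ dy
    κ-dx = trans (cong (τ dvx dv'y) (trans (cong (τ dx dy) (τ-other (≢-by-labels refl (lab-σ dy) x≢y) (≢-sym σdx≢dx)))
                                           (τ-left dx dy)))
                 (τ-other (≢-by-labels refl refl y≢v) (≢-by-labels refl refl y≢v′))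

    κ-dy : κ₀ dy ≡ dx
    κ-dy = trans (cong (τ dvx dv'y) (trans (cong (τ dx dy) (τ-other (≢-sym σdy≢dy) (≢-by-labels refl (lab-σ dx) (≢-sym x≢y))))
                                           (τ-right dx dy)))
                 (τ-other (≢-by-labels refl refl x≢v) (≢-by-labels refl refl x≢v′))

    κ-σdy : κ₀ (σ dy) ≡ σ dx
    κ-σdy = trans (cong (τ dvx dv'y) (trans (cong (τ dx dy) (τ-left (σ dy) (σ dx)))
                                            (τ-other σdx≢dx (≢-by-labels (lab-σ dx) refl x≢y))))
                  (τ-other (≢-by-labels (lab-σ dx) refl x≢v) (≢-by-labels (lab-σ dx) refl x≢v′))

    κ-σdx : κ₀ (σ dx) ≡ σ dy
    κ-σdx = trans (cong (τ dvx dv'y) (trans (cong (τ dx dy) (τ-right (σ dy) (σ dx)))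
                                            (τ-other (≢-by-labels (lab-σ dy) refl (≢-sym x≢y)) σdy≢dy)))
                  (τ-other (≢-by-labels (lab-σ dy) refl y≢v) (≢-by-labels (lab-σ dy) refl y≢v′))

    κ-at-w : ∀ {z} → lab z ≡ Lw → κ₀ z ≡ z
    κ-at-w at-w = κ-unmerged (¬OneOf (≢-sym x≢w) (≢-sym y≢w) ∘ subst (OneOf Lx Ly) at-w)
                             (¬OneOf (≢-sym v≢w) w≢v′ ∘ subst (OneOf Lv Lv′) at-w)

    κ-at-w′ : ∀ {z} → lab z ≡ Lw′ → κ₀ z ≡ z
    κ-at-w′ at-w′ = κ-unmerged (¬OneOf (≢-sym x≢w′) (≢-sym y≢w′) ∘ subst (OneOf Lx Ly) at-w′)
                               (¬OneOf (≢-sym v≢w′) w′≢v′ ∘ subst (OneOf Lv Lv′) at-w′)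

    rev-≢-by-labels : ∀ {a k A B} → lab a ≡ A → lab (rev k) ≡ B → A ≢ B → rev a ≢ k
    rev-≢-by-labels a-at rev-k-at A≢B = ≢-by-labels a-at rev-k-at A≢B ∘ rev-swap

    κ-rev-p₁ : κ₀ (rev p₁) ≡ rev p₁
    κ-rev-p₁ = κ-other (rev-≢-by-labels (lab-σ⁻ dvx) refl v≢w) (rev-≢-by-labels (lab-σ⁻ dvx) refl v≢w′)
                       (rev-≢-by-labels (lab-σ⁻ dvx) refl (≢-sym y≢v)) (rev-≢-by-labels (lab-σ⁻ dvx) refl (≢-sym x≢v))
                       (rev-≢-by-labels (lab-σ⁻ dvx) lab-rev-dvx (≢-sym x≢v))
                       (rev-≢-by-labels (lab-σ⁻ dvx) lab-rev-dv'y (≢-sym y≢v))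

    κ-rev-q₁ : κ₀ (rev q₁) ≡ rev q₁
    κ-rev-q₁ = κ-other (rev-≢-by-labels (lab-σ⁻ dv'y) refl (≢-sym w≢v′)) (rev-≢-by-labels (lab-σ⁻ dv'y) refl (≢-sym w′≢v′))
                       (rev-≢-by-labels (lab-σ⁻ dv'y) refl (≢-sym y≢v′)) (rev-≢-by-labels (lab-σ⁻ dv'y) refl (≢-sym x≢v′))
                       (rev-≢-by-labels (lab-σ⁻ dv'y) lab-rev-dvx (≢-sym x≢v′))
                       (rev-≢-by-labels (lab-σ⁻ dv'y) lab-rev-dv'y (≢-sym y≢v′))

    φG-dvx : φ G dvx ≡ dx
    φG-dvx = trans (cong σ (rev-involutive (σ (σ dx)))) (proj₁ deg-x)

    φG-dv'y : φ G dv'y ≡ dy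
    φG-dv'y = trans (cong σ (rev-involutive (σ (σ dy)))) (proj₁ deg-y)

    φH-dvx : φ H dvx ≡ dx
    φH-dvx = trans (cong σH (rev-involutive (σ (σ dx)))) (trans (σH-at-x (lab-σσ dx)) (proj₁ deg-x))

    φH-dv'y : φ H dv'y ≡ dy
    φH-dv'y = trans (cong σH (rev-involutive (σ (σ dy)))) (trans (σH-at-y (lab-σσ dy)) (proj₁ deg-y))

    κ-conj-other : ∀ {d} → d ≢ dvx → d ≢ dv'y → d ≢ dx → d ≢ dy → d ≢ σ dy → d ≢ σ dx →
                   d ≢ rev p₁ → d ≢ rev q₁ → φ H (κ₀ d) ≡ κ₀ (φ G d)
    κ-conj-other {d} d≢dvx d≢dv'y d≢dx d≢dy d≢σdy d≢σdx d≢rev-p₁ d≢rev-q₁ = begin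
      φ H (κ₀ d)     ≡⟨ cong (φ H) (κ-other d≢σdy d≢σdx d≢dx d≢dy d≢dvx d≢dv'y) ⟩
      σH (rev d)     ≡⟨ σH-other (d≢rev-p₁ ∘ rev-swap) (d≢rev-q₁ ∘ rev-swap)
                                 (λ eq → d≢σdy (trans (rev-swap eq) (rev-involutive (σ dy))))
                                 (λ eq → d≢σdx (trans (rev-swap eq) (rev-involutive (σ dx)))) ⟩
      σ (rev d)      ≡⟨ sym (κ-other (d≢dx ∘ rev-swap ∘ σ-injective) (d≢dy ∘ rev-swap ∘ σ-injective)
                          (λ eq → d≢dvx (rev-swap (σ-injective (trans eq (sym (proj₁ deg-x))))))
                          (λ eq → d≢dv'y (rev-swap (σ-injective (trans eq (sym (proj₁ deg-y))))))
                          (λ eq → d≢rev-p₁ (rev-swap (σ-injective (trans eq (sym (σ∘σ⁻ dvx))))))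
                          (λ eq → d≢rev-q₁ (rev-swap (σ-injective (trans eq (sym (σ∘σ⁻ dv'y))))))) ⟩
      κ₀ (σ (rev d)) ∎
      where open ≡-Reasoning

    κ-conj : ∀ d → φ H (κ₀ d) ≡ κ₀ (φ G d)
    -- Decided as k ≟D d: the tests d ≟D k occur inside κ₀ d, and with-abstracting them
    -- would spoil the goal.
    κ-conj d with dvx ≟D d
    ... | yes refl = trans (cong (φ H) κ-dvx) (trans φH-dv'y (sym (trans (cong κ₀ φG-dvx) κ-dx)))
    ... | no dvx≢d with dv'y ≟D d
    ... | yes refl = trans (cong (φ H) κ-dv'y) (trans φH-dvx (sym (trans (cong κ₀ φG-dv'y) κ-dy)))
    ... | no dv'y≢d with dx ≟D d
    ... | yes refl = trans (cong (φ H) κ-dx) (trans (σH-at-x refl) (sym κ-σdy))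
    ... | no dx≢d with dy ≟D d
    ... | yes refl = trans (cong (φ H) κ-dy) (trans (σH-at-y refl) (sym κ-σdx))
    ... | no dy≢d with σ dy ≟D d
    ... | yes refl = trans (cong (φ H) κ-σdy) (trans σH-dw'x (sym (κ-at-w (lab-σ dwy))))
    ... | no σdy≢d with σ dx ≟D d
    ... | yes refl = trans (cong (φ H) κ-σdx) (trans σH-dwy (sym (κ-at-w′ (lab-σ dw'x))))
    ... | no σdx≢d with rev p₁ ≟D d
    ... | yes refl = trans (cong (φ H) κ-rev-p₁)
                           (trans (cong σH (rev-involutive p₁))
                                  (trans σH-p₁ (sym (trans (cong (κ₀ ∘ σ) (rev-involutive p₁))
                                                           (trans (cong κ₀ (σ∘σ⁻ dvx)) κ-dvx)))))
    ... | no rev-p₁≢d with rev q₁ ≟D d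
    ... | yes refl = trans (cong (φ H) κ-rev-q₁)
                           (trans (cong σH (rev-involutive q₁))
                                  (trans σH-q₁ (sym (trans (cong (κ₀ ∘ σ) (rev-involutive q₁))
                                                           (trans (cong κ₀ (σ∘σ⁻ dv'y)) κ-dv'y)))))
    ... | no rev-q₁≢d = κ-conj-other (≢-sym dvx≢d) (≢-sym dv'y≢d) (≢-sym dx≢d) (≢-sym dy≢d) (≢-sym σdy≢d)
                                     (≢-sym σdx≢d) (≢-sym rev-p₁≢d) (≢-sym rev-q₁≢d)

    module Faces = ConjugateFaces G H κ κ-conj

    face-v′-x : SameOrbit (φ H) dv'y (σ dx)
    face-v′-x = SameOrbit-trans (SameOrbit-step φH-dv'y) (SameOrbit-step (σH-at-x refl))

    face-v-y : SameOrbit (φ H) dvx (σ dy)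
    face-v-y = SameOrbit-trans (SameOrbit-step φH-dvx) (SameOrbit-step (σH-at-y refl))

    face-w′-x : SameOrbit (φ H) dw'x (σ (σ dx))
    face-w′-x = SameOrbit-step (trans (cong σH (rev-involutive (σ dx))) (σH-at-x (lab-σ dx)))

    face-w-y : SameOrbit (φ H) dwy (σ (σ dy))
    face-w-y = SameOrbit-step (trans (cong σH (rev-involutive (σ dy))) (σH-at-y (lab-σ dy)))

    κ-rev-dvx : κ₀ (rev dvx) ≡ σ (σ dx)
    κ-rev-dvx = trans (cong κ₀ (rev-involutive (σ (σ dx))))
      (κ-other (≢-by-labels (lab-σσ dx) (lab-σ dy) x≢y) (σdx≢dx ∘ σ-injective) σσdx≢dx
               (≢-by-labels (lab-σσ dx) refl x≢y) (≢-by-labels (lab-σσ dx) refl x≢v) (≢-by-labels (lab-σσ dx) refl x≢v′))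

    κ-rev-dv'y : κ₀ (rev dv'y) ≡ σ (σ dy)
    κ-rev-dv'y = trans (cong κ₀ (rev-involutive (σ (σ dy))))
      (κ-other (σdy≢dy ∘ σ-injective) (≢-by-labels (lab-σσ dy) (lab-σ dx) (≢-sym x≢y))
               (≢-by-labels (lab-σσ dy) refl (≢-sym x≢y)) σσdy≢dy (≢-by-labels (lab-σσ dy) refl y≢v) (≢-by-labels (lab-σσ dy) refl y≢v′))

    Ea Eb Ec Ed : Fin m
    Ea = proj₁ dvx
    Eb = proj₁ (σ dx)
    Ec = proj₁ dv'y
    Ed = proj₁ (σ dy)

    Ea≢Ec : Ea ≢ Ec
    Ea≢Ec = edge-≢ (≢-by-labels refl refl v≢v′) (≢-by-labels refl lab-rev-dv'y (≢-sym y≢v))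

    Ea≢Ed : Ea ≢ Ed
    Ea≢Ed = edge-≢ (≢-by-labels refl (lab-σ dy) (≢-sym y≢v)) (≢-by-labels refl refl v≢w)

    Eb≢Ec : Eb ≢ Ec
    Eb≢Ec = edge-≢ (≢-by-labels (lab-σ dx) refl x≢v′) (≢-by-labels (lab-σ dx) lab-rev-dv'y x≢y)

    Eb≢Ed : Eb ≢ Ed
    Eb≢Ed = edge-≢ (≢-by-labels (lab-σ dx) (lab-σ dy) x≢y) (≢-by-labels (lab-σ dx) refl x≢w)

    Ea≢e : Ea ≢ e
    Ea≢e = edge-≢ {b = dx} (≢-by-labels refl refl (≢-sym x≢v)) (≢-by-labels refl refl (≢-sym y≢v))

    Eb≢e : Eb ≢ e
    Eb≢e = edge-≢ {b = dx} σdx≢dx (≢-by-labels (lab-σ dx) refl x≢y)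

    Ec≢e : Ec ≢ e
    Ec≢e = edge-≢ {b = dx} (≢-by-labels refl refl (≢-sym x≢v′)) (≢-by-labels refl refl (≢-sym y≢v′))

    Ed≢e : Ed ≢ e
    Ed≢e = edge-≢ {b = dx} (≢-by-labels (lab-σ dy) refl (≢-sym x≢y)) σdy≢dy

    χ : Fin m ↔ Fin m
    χ = transpose Ec Ed ∘ₚ transpose Ea Eb

    χ-Ea : Inverse.to χ Ea ≡ Eb
    χ-Ea = trans (cong (PC.transpose Ea Eb) (transpose-other Ea≢Ec Ea≢Ed)) (transpose-left Ea Eb)

    χ-Eb : Inverse.to χ Eb ≡ Ea
    χ-Eb = trans (cong (PC.transpose Ea Eb) (transpose-other Eb≢Ec Eb≢Ed)) (transpose-right Ea Eb)

    χ-Ec : Inverse.to χ Ec ≡ Ed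
    χ-Ec = trans (cong (PC.transpose Ea Eb) (transpose-left Ec Ed)) (transpose-other (≢-sym Ea≢Ed) (≢-sym Eb≢Ed))

    χ-Ed : Inverse.to χ Ed ≡ Ec
    χ-Ed = trans (cong (PC.transpose Ea Eb) (transpose-right Ec Ed)) (transpose-other (≢-sym Ea≢Ec) (≢-sym Eb≢Ec))

    χ-other : ∀ {e′} → e′ ≢ Ea → e′ ≢ Eb → e′ ≢ Ec → e′ ≢ Ed → Inverse.to χ e′ ≡ e′
    χ-other e′≢Ea e′≢Eb e′≢Ec e′≢Ed =
      trans (cong (PC.transpose Ea Eb) (transpose-other e′≢Ec e′≢Ed)) (transpose-other e′≢Ea e′≢Eb)

    edgeMatch : ∀ e′ → Faces.EdgeMatch (Inverse.to χ) e′
    edgeMatch e′ with Ea Fin.≟ e′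
    ... | yes refl = dvx , σ dx , refl , sym χ-Ea ,
                     inj₁ (subst (λ a → SameOrbit (φ H) a (σ dx)) (sym κ-dvx) face-v′-x) ,
                     inj₂ (subst (SameOrbit (φ H) dw'x) (sym κ-rev-dvx) face-w′-x)
    ... | no Ea≢e′ with Eb Fin.≟ e′
    ... | yes refl = σ dx , dvx , refl , sym χ-Eb ,
                     inj₂ (subst (SameOrbit (φ H) dvx) (sym κ-σdx) face-v-y) ,
                     inj₁ (subst₂ (SameOrbit (φ H)) (sym (κ-at-w′ refl)) (sym (rev-involutive (σ (σ dx)))) face-w′-x)
    ... | no Eb≢e′ with Ec Fin.≟ e′
    ... | yes refl = dv'y , σ dy , refl , sym χ-Ec ,
                     inj₁ (subst (λ a → SameOrbit (φ H) a (σ dy)) (sym κ-dv'y) face-v-y) ,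
                     inj₂ (subst (SameOrbit (φ H) dwy) (sym κ-rev-dv'y) face-w-y)
    ... | no Ec≢e′ with Ed Fin.≟ e′
    ... | yes refl = σ dy , dv'y , refl , sym χ-Ed ,
                     inj₂ (subst (SameOrbit (φ H) dv'y) (sym κ-σdy) face-v′-x) ,
                     inj₁ (subst₂ (SameOrbit (φ H)) (sym (κ-at-w refl)) (sym (rev-involutive (σ (σ dy)))) face-w-y)
    ... | no Ed≢e′ with e Fin.≟ e′
    ... | yes refl = dx , dy , refl ,
                     sym (χ-other (≢-sym Ea≢e) (≢-sym Eb≢e) (≢-sym Ec≢e) (≢-sym Ed≢e)) ,
                     inj₁ (0 , κ-dx) , inj₁ (0 , κ-dy)
    ... | no e≢e′ = (e′ , true) , (e′ , true) , refl ,
                    sym (χ-other (≢-sym Ea≢e′) (≢-sym Eb≢e′) (≢-sym Ec≢e′) (≢-sym Ed≢e′)) ,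
                    inj₁ (0 , κ-fixes true) , inj₁ (0 , κ-fixes false)
      where
        κ-fixes : ∀ b → κ₀ (e′ , b) ≡ (e′ , b)
        κ-fixes b = κ-other (Ed≢e′ ∘ sym ∘ cong proj₁) (Eb≢e′ ∘ sym ∘ cong proj₁) (e≢e′ ∘ sym ∘ cong proj₁)
                            (e≢e′ ∘ sym ∘ cong proj₁) (Ea≢e′ ∘ sym ∘ cong proj₁) (Ec≢e′ ∘ sym ∘ cong proj₁)

    dualsIsomorphic : DualsIsomorphic G H
    dualsIsomorphic = Faces.dual-≅ χ edgeMatch

mainTheorem8 : ∀ {m} (G : RotSys m) (g : ℕ) (e : Fin m) →
    IsEmbeddedGraph G → IsSimple G → HasGenus G g →
    HApplicable G e → IsSimple (Hop G e) →
    IsEmbeddedGraph (Hop G e) × IsSimple (Hop G e) × HasGenus (Hop G e) (suc g) ×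
    HasTwoCut (Hop G e) × DualsIsomorphic G (Hop G e)
mainTheorem8 G g e (perm , conn) (noLoops , noMultiEdges) (nv , nf , VL , FL , euler)
             (_ , minDeg , deg-x , deg-y , v≁w′ , v≁w , v≁v′ , w′≁w , w′≁v′ , w≁v′) (noLoopsH , noMultiEdgesH)
  with OrbitLabelling-≥2 G VL v≁w′
... | s≤s (s≤s _) =
  (I₂.isPermutation , M₂.connected (M₁.connected conn)) ,
  (noLoopsH , noMultiEdgesH) ,
  (_ , nf , M₂.vertexLabelling , Faces.faceLabelling FL , genus-step _ nf g _ euler) ,
  twoCut noLoopsH noMultiEdgesH ,
  dualsIsomorphic
  where
    open HOperation.Properties G e perm VL noLoops noMultiEdges minDeg deg-x deg-y v≁w′ v≁w v≁v′ w′≁w w′≁v′ w≁v′
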